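{- The number of vertex-resilient blocks in a digraph $G$ with $n$ vertices is at most $n-1$.
   Context: Let $G=(V,E)$ be a digraph. Two distinct vertices $v,w$ are vertex-resilient, written $v\leftrightarrow_{\mathrm{vr}} w$, if for every vertex $z\notin\{v,w\}$, $v$ and $w$ lie in the same strongly connected component of $G\setminus z$. A vertex-resilient block is a maximal set $B\subseteq V$ with $|B|\ge 2$ such that $u\leftrightarrow_{\mathrm{vr}} v$ for all distinct $u,v\in B$ (singleton blocks are not counted). -}

module Defs where

open import Data.Nat using (ℕ; _≤_)
open import Data.Fin using (Fin)
open import Data.Fin.Subset using (Subset; _∈_; _⊆_; ∣_∣)
open import Data.Bool using (Bool; true)
open import Data.Product using (_×_)
open import Relation.Binary.PropositionalEquality using (_≡_; _≢_)

Digraph : ℕ → Set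
Digraph n = Fin n → Fin n → Bool

data ReachAvoid {n : ℕ} (E : Digraph n) (z : Fin n) : Fin n → Fin n → Set where
  here : ∀ {u} → u ≢ z → ReachAvoid E z u u
  step : ∀ {u x v} → u ≢ z → E u x ≡ true → ReachAvoid E z x v → ReachAvoid E z u v

SameSCC-del : {n : ℕ} → Digraph n → Fin n → Fin n → Fin n → Set
SameSCC-del E z v w = ReachAvoid E z v w × ReachAvoid E z w v

VR : {n : ℕ} → Digraph n → Fin n → Fin n → Set
VR E v w = v ≢ w × (∀ z → z ≢ v → z ≢ w → SameSCC-del E z v w)

PairwiseVR : {n : ℕ} → Digraph n → Subset n → Set
PairwiseVR E B = ∀ {u v} → u ∈ B → v ∈ B → u ≢ v → VR E u v

IsVRBlock : {n : ℕ} → Digraph n → Subset n → Set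
IsVRBlock E B =
  (2 ≤ ∣ B ∣) × PairwiseVR E B × (∀ B′ → B ⊆ B′ → PairwiseVR E B′ → B′ ⊆ B)

module Submission where

-- Choose in every block B two distinct vertices x_B, y_B and regard the
-- pairs (x_B , y_B) as undirected edges on the vertex set.  Adding these
-- edges block by block, each one joins two different components:
-- otherwise x_B and y_B are linked by a chain of earlier blocks, and
-- looking at the last time this chain leaves x_B through a block C one
-- finds that C meets B in x_B and that B, C are strongly connected in
-- G ∖ x_B; then B ∪ C is still pairwise vertex-resilient, so maximality
-- forces C = B, contradicting that the blocks are distinct.

open import Defs
open import Data.Nat using (ℕ; zero; suc; _≤_; _∸_; z≤n; s≤s)
open import Data.Fin using (Fin; zero; suc; _≟_; punchOut)
open import Data.Fin.Properties using (punchOut-injective; suc-injective)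
open import Data.Fin.Subset using (Subset; _∈_; _⊆_; ∣_∣; _∪_; inside; outside)
open import Data.Fin.Subset.Properties using (⊆-antisym; p⊆p∪q; q⊆p∪q; x∈p∪q⁻)
open import Data.Vec using (_∷_; here; there)
open import Data.List using (List; []; _∷_; length; map)
open import Data.List.Properties using (length-map)
open import Data.List.Membership.Propositional using () renaming (_∈_ to _∈ₗ_)
open import Data.List.Membership.Propositional.Properties using (∈-map⁻)
open import Data.List.Relation.Unary.All using (All; []; _∷_)
import Data.List.Relation.Unary.All as All
open import Data.List.Relation.Unary.Any using (here; there)
open import Data.List.Relation.Unary.AllPairs using (_∷_)
open import Data.List.Relation.Unary.Unique.Propositional using (Unique)
open import Data.Product using (Σ; ∃-syntax; _×_; _,_; proj₁; proj₂)
import Data.Product as Product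
open import Data.Sum using (_⊎_; inj₁; inj₂)
import Data.Sum as Sum
open import Data.Empty using (⊥-elim)
open import Data.Unit using (⊤; tt)
open import Function using (_∘_)
open import Relation.Nullary using (¬_; yes; no)
open import Relation.Binary.PropositionalEquality using (_≡_; _≢_; refl; sym; trans; cong; subst)
open import Relation.Binary.Construct.Closure.ReflexiveTransitive using (Star; ε; _◅_; _◅◅_)
import Relation.Binary.Construct.Closure.ReflexiveTransitive as Star

Edge : ℕ → Set
Edge n = Fin n × Fin n

Linked : ∀ {n} → List (Edge n) → Fin n → Fin n → Set
Linked L x y = (x , y) ∈ₗ L ⊎ (y , x) ∈ₗ L

Connected : ∀ {n} → List (Edge n) → Fin n → Fin n → Set
Connected L = Star (Linked L)

-- Adding the edges of L one by one to the edges acc, every new edge joins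
-- two different components; i.e. acc ++ L is acyclic if acc was.
GrowsForest : ∀ {n} → List (Edge n) → List (Edge n) → Set
GrowsForest acc [] = ⊤
GrowsForest acc ((a , b) ∷ L) = ¬ Connected acc a b × GrowsForest ((a , b) ∷ acc) L

rename : ∀ {m k} → (Fin m → Fin k) → List (Edge m) → List (Edge k)
rename f = map (Product.map f f)

Fibred : ∀ {m k} → (Fin m → Fin k) → List (Edge m) → Set
Fibred f K = ∀ {c c′} → f c ≡ f c′ → Connected K c c′

connected-weaken : ∀ {n} {K : List (Edge n)} {e x y} → Connected K x y → Connected (e ∷ K) x y
connected-weaken = Star.map (Sum.map there there)

linked-rename⁻ : ∀ {m k} (f : Fin m → Fin k) (K : List (Edge m)) {p q} →
                 Linked (rename f K) p q →
                 ∃[ x ] ∃[ y ] (Linked K x y × f x ≡ p × f y ≡ q)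
linked-rename⁻ f K (inj₁ pq∈) with ∈-map⁻ (Product.map f f) pq∈
... | (x , y) , xy∈ , refl = x , y , inj₁ xy∈ , refl , refl
linked-rename⁻ f K (inj₂ qp∈) with ∈-map⁻ (Product.map f f) qp∈
... | (y , x) , yx∈ , refl = x , y , inj₂ yx∈ , refl , refl

connected-reflect : ∀ {m k} (f : Fin m → Fin k) {K : List (Edge m)} → Fibred f K →
                    ∀ {p q} → Connected (rename f K) p q →
                    ∀ {c d} → f c ≡ p → f d ≡ q → Connected K c d
connected-reflect f fibred ε fc≡p fd≡p = fibred (trans fc≡p (sym fd≡p))
connected-reflect f {K} fibred (e ◅ r) fc≡p fd≡q with linked-rename⁻ f K e
... | x , y , xy , fx≡p , fy≡p′ =
  fibred (trans fc≡p (sym fx≡p)) ◅◅ xy ◅ connected-reflect f fibred r fy≡p′ fd≡q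

grows-rename : ∀ {m k} (f : Fin m → Fin k) {acc : List (Edge m)} → Fibred f acc →
               ∀ L → GrowsForest acc L → GrowsForest (rename f acc) (rename f L)
grows-rename f fibred [] tt = tt
grows-rename f fibred ((c , d) ∷ L) (c≁d , grows) =
    (λ fc∼fd → c≁d (connected-reflect f fibred fc∼fd refl refl))
  , grows-rename f (connected-weaken ∘ fibred) L grows

-- Contraction of b onto a: b is sent where a goes, other vertices keep their order.
identify : ∀ {n} {a b : Fin (suc n)} → b ≢ a → Fin (suc n) → Fin n
identify {b = b} b≢a x with b ≟ x
... | yes _ = punchOut b≢a
... | no b≢x = punchOut b≢x

identify-fibred : ∀ {n} {a b : Fin (suc n)} (b≢a : b ≢ a) {K : List (Edge (suc n))} →
                  Linked K a b → Fibred (identify b≢a) K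
identify-fibred {b = b} b≢a ab {c} {c′} eq with b ≟ c | b ≟ c′
... | yes refl | yes refl = ε
... | yes refl | no b≢c′ rewrite punchOut-injective b≢a b≢c′ eq = Sum.swap ab ◅ ε
... | no b≢c | yes refl rewrite punchOut-injective b≢c b≢a eq = ab ◅ ε
... | no b≢c | no b≢c′ rewrite punchOut-injective b≢c b≢c′ eq = ε

forest-size : ∀ n (acc L : List (Edge n)) → GrowsForest acc L → length L ≤ n ∸ 1
forest-size n acc [] _ = z≤n
forest-size zero acc ((() , _) ∷ L) _
forest-size (suc zero) acc ((zero , zero) ∷ L) (a≁a , _) = ⊥-elim (a≁a ε)
forest-size (suc (suc n)) acc ((a , b) ∷ L) (a≁b , grows) =
  s≤s (subst (_≤ n) (length-map (Product.map φ φ) L)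
    (forest-size (suc n) _ (rename φ L)
      (grows-rename φ (identify-fibred b≢a (inj₁ (here refl))) L grows)))
  where
  b≢a : b ≢ a
  b≢a refl = a≁b ε
  φ : Fin (suc (suc n)) → Fin (suc n)
  φ = identify b≢a

DistinctPair : ∀ {n} → Subset n → Edge n → Set
DistinctPair p (x , y) = x ∈ p × y ∈ p × x ≢ y

pick-one : ∀ {n} (p : Subset n) → 1 ≤ ∣ p ∣ → ∃[ x ] x ∈ p
pick-one (inside ∷ p) _ = zero , here
pick-one (outside ∷ p) h with pick-one p h
... | x , x∈p = suc x , there x∈p

pick-two : ∀ {n} (p : Subset n) → 2 ≤ ∣ p ∣ → Σ (Edge n) (DistinctPair p)
pick-two (inside ∷ p) (s≤s h) with pick-one p h
... | y , y∈p = (zero , suc y) , here , there y∈p , λ ()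
pick-two (outside ∷ p) h with pick-two p h
... | (x , y) , x∈p , y∈p , x≢y = (suc x , suc y) , there x∈p , there y∈p , x≢y ∘ suc-injective

module Resilience {n : ℕ} (E : Digraph n) where

  reach-trans : ∀ {z u v w} → ReachAvoid E z u v → ReachAvoid E z v w → ReachAvoid E z u w
  reach-trans (here u≢z) q = q
  reach-trans (step u≢z ux r) q = step u≢z ux (reach-trans r q)

  scc-refl : ∀ {z u} → z ≢ u → SameSCC-del E z u u
  scc-refl z≢u = here (z≢u ∘ sym) , here (z≢u ∘ sym)

  scc-sym : ∀ {z u v} → SameSCC-del E z u v → SameSCC-del E z v u
  scc-sym (uv , vu) = vu , uv

  scc-trans : ∀ {z u v w} → SameSCC-del E z u v → SameSCC-del E z v w → SameSCC-del E z u w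
  scc-trans (uv , vu) (vw , wv) = reach-trans uv vw , reach-trans wv vu

  within : ∀ {S} → PairwiseVR E S → ∀ {z u v} → u ∈ S → v ∈ S → z ≢ u → z ≢ v →
           SameSCC-del E z u v
  within pw {z} {u} {v} u∈S v∈S z≢u z≢v with u ≟ v
  ... | yes refl = scc-refl z≢u
  ... | no u≢v = proj₂ (pw u∈S v∈S u≢v) z z≢u z≢v

  -- Two pairwise vertex-resilient sets B, C sharing a vertex x merge into
  -- one, provided some y ∈ B and p ∈ C other than x are strongly connected
  -- in G ∖ x: deleting x, everything routes through y and p; deleting
  -- any other vertex, everything routes through x.
  ∪-pairwiseVR : ∀ {B C x y p} → PairwiseVR E B → PairwiseVR E C →
                 x ∈ B → x ∈ C → y ∈ B → p ∈ C → x ≢ y → x ≢ p →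
                 SameSCC-del E x y p → PairwiseVR E (B ∪ C)
  ∪-pairwiseVR {B} {C} {x} pwB pwC x∈B x∈C y∈B p∈C x≢y x≢p y∼p {u} {v} u∈B∪C v∈B∪C u≢v =
    u≢v , λ z z≢u z≢v → across (x∈p∪q⁻ B C u∈B∪C) (x∈p∪q⁻ B C v∈B∪C) z≢u z≢v
    where
    B-to-C : ∀ {z u w} → u ∈ B → w ∈ C → z ≢ u → z ≢ w → SameSCC-del E z u w
    B-to-C {z} u∈B w∈C z≢u z≢w with z ≟ x
    ... | no z≢x = scc-trans (within pwB u∈B x∈B z≢u z≢x) (within pwC x∈C w∈C z≢x z≢w)
    ... | yes refl = scc-trans (within pwB u∈B y∈B z≢u x≢y)
                       (scc-trans y∼p (within pwC p∈C w∈C x≢p z≢w))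
    across : ∀ {z} → u ∈ B ⊎ u ∈ C → v ∈ B ⊎ v ∈ C → z ≢ u → z ≢ v → SameSCC-del E z u v
    across (inj₁ u∈B) (inj₁ v∈B) z≢u z≢v = within pwB u∈B v∈B z≢u z≢v
    across (inj₂ u∈C) (inj₂ v∈C) z≢u z≢v = within pwC u∈C v∈C z≢u z≢v
    across (inj₁ u∈B) (inj₂ v∈C) z≢u z≢v = B-to-C u∈B v∈C z≢u z≢v
    across (inj₂ u∈C) (inj₁ v∈B) z≢u z≢v = scc-sym (B-to-C v∈B u∈C z≢v z≢u)

  blocks-meet : ∀ {B C x y p} → IsVRBlock E B → IsVRBlock E C →
                x ∈ B → x ∈ C → y ∈ B → p ∈ C → x ≢ y → x ≢ p →
                SameSCC-del E x y p → B ≡ C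
  blocks-meet {B} {C} (_ , pwB , maxB) (_ , pwC , maxC) x∈B x∈C y∈B p∈C x≢y x≢p y∼p =
    ⊆-antisym B⊆C C⊆B
    where
    B∪C⊆B : B ∪ C ⊆ B
    B∪C⊆B = maxB (B ∪ C) (p⊆p∪q C) (∪-pairwiseVR pwB pwC x∈B x∈C y∈B p∈C x≢y x≢p y∼p)
    C⊆B : C ⊆ B
    C⊆B = B∪C⊆B ∘ q⊆p∪q B C
    B⊆C : B ⊆ C
    B⊆C = maxC B C⊆B pwB

  module Chains (cs : List (Subset n)) where

    SharesBlock : Fin n → Fin n → Set
    SharesBlock x y = ∃[ C ] (C ∈ₗ cs × x ∈ C × y ∈ C)

    Chain : Fin n → Fin n → Set
    Chain = Star SharesBlock

    Avoids : ∀ {s t} → Fin n → Chain s t → Set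
    Avoids {s} z ε = z ≢ s
    Avoids {s} z (_ ◅ q) = z ≢ s × Avoids z q

    avoids-start : ∀ {s t z} (q : Chain s t) → Avoids z q → z ≢ s
    avoids-start ε z≢s = z≢s
    avoids-start (_ ◅ q) (z≢s , _) = z≢s

    chain-scc : All (PairwiseVR E) cs → ∀ {s t z} (q : Chain s t) → Avoids z q →
                SameSCC-del E z s t
    chain-scc pws ε z≢s = scc-refl z≢s
    chain-scc pws ((C , C∈ , s∈C , r∈C) ◅ q) (z≢s , av) =
      scc-trans (within (All.lookup pws C∈) s∈C r∈C z≢s (avoids-start q av)) (chain-scc pws q av)

    LastDeparture : Fin n → Fin n → Set
    LastDeparture x y = ∃[ p ] (SharesBlock x p × Σ (Chain p y) (Avoids x))

    avoid-or-depart : ∀ {x s y} → x ≢ y → (q : Chain s y) → Avoids x q ⊎ LastDeparture x y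
    avoid-or-depart x≢y ε = inj₁ x≢y
    avoid-or-depart {x} x≢y (_◅_ {i = s} e q) with avoid-or-depart x≢y q
    ... | inj₂ departure = inj₂ departure
    ... | inj₁ av with x ≟ s
    ...   | yes refl = inj₂ (_ , e , q , av)
    ...   | no x≢s = inj₁ (x≢s , av)

    last-departure : ∀ {x y} → x ≢ y → Chain x y → LastDeparture x y
    last-departure x≢y q with avoid-or-depart x≢y q
    ... | inj₁ av = ⊥-elim (avoids-start q av refl)
    ... | inj₂ departure = departure

    no-chain : ∀ {B x y} → IsVRBlock E B → All (IsVRBlock E) cs → All (_≢ B) cs →
               x ∈ B → y ∈ B → x ≢ y → ¬ Chain x y
    no-chain isB areBlocks cs≢B x∈B y∈B x≢y q with last-departure x≢y q
    ... | p , (C , C∈ , x∈C , p∈C) , q′ , av =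
      All.lookup cs≢B C∈ (sym (blocks-meet isB (All.lookup areBlocks C∈)
        x∈B x∈C y∈B p∈C x≢y (avoids-start q′ av)
        (scc-sym (chain-scc (All.map (proj₁ ∘ proj₂) areBlocks) q′ av))))

  open Chains using (SharesBlock; no-chain)

  representative : ∀ {B} → IsVRBlock E B → Edge n
  representative {B} isB = proj₁ (pick-two B (proj₁ isB))

  representative-spans : ∀ {B} (isB : IsVRBlock E B) → DistinctPair B (representative isB)
  representative-spans {B} isB = proj₂ (pick-two B (proj₁ isB))

  representatives : ∀ {bs} → All (IsVRBlock E) bs → List (Edge n)
  representatives = All.reduce representative

  length-representatives : ∀ {bs} (areBlocks : All (IsVRBlock E) bs) →
                           length (representatives areBlocks) ≡ length bs
  length-representatives [] = refl
  length-representatives (_ ∷ areBlocks) = cong suc (length-representatives areBlocks)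

  representative-shares : ∀ {bs} (areBlocks : All (IsVRBlock E) bs) {x y} →
                          (x , y) ∈ₗ representatives areBlocks → SharesBlock bs x y
  representative-shares {B ∷ _} (isB ∷ _) (here refl) with representative-spans isB
  ... | x∈B , y∈B , _ = B , here refl , x∈B , y∈B
  representative-shares (_ ∷ areBlocks) (there xy∈) with representative-shares areBlocks xy∈
  ... | C , C∈ , x∈C , y∈C = C , there C∈ , x∈C , y∈C

  linked-shares : ∀ {bs} (areBlocks : All (IsVRBlock E) bs) {x y} →
                  Linked (representatives areBlocks) x y → SharesBlock bs x y
  linked-shares areBlocks (inj₁ xy∈) = representative-shares areBlocks xy∈
  linked-shares areBlocks (inj₂ yx∈) with representative-shares areBlocks yx∈
  ... | C , C∈ , y∈C , x∈C = C , C∈ , x∈C , y∈C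

  representatives-grow : ∀ {pre bs} (preBlocks : All (IsVRBlock E) pre)
                         (areBlocks : All (IsVRBlock E) bs) → Unique bs →
                         All (λ C → All (C ≢_) bs) pre →
                         GrowsForest (representatives preBlocks) (representatives areBlocks)
  representatives-grow preBlocks [] _ _ = tt
  representatives-grow {pre} preBlocks (isB ∷ areBlocks) (B≢bs ∷ unique) pre≢bs
    with representative-spans isB
  ... | x∈B , y∈B , x≢y =
      (λ x∼y → no-chain pre isB preBlocks (All.map All.head pre≢bs) x∈B y∈B x≢y
                 (Star.map (linked-shares preBlocks) x∼y))
    , representatives-grow (isB ∷ preBlocks) areBlocks unique (B≢bs ∷ All.map All.tail pre≢bs)

lemma4 : (n : ℕ) (E : Digraph n) (blocks : List (Subset n)) →
         Unique blocks → All (IsVRBlock E) blocks → length blocks ≤ n ∸ 1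
lemma4 n E blocks unique areBlocks =
  subst (_≤ n ∸ 1) (length-representatives areBlocks)
    (forest-size n [] (representatives areBlocks) (representatives-grow [] areBlocks unique []))
  where open Resilience E
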